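{- For every integer $n \geq 3$, the cycle $C_n$ on $n$ vertices satisfies $$\chi^=_1(C_n) = \begin{cases} 2 & \text{if } n \text{ is divisible by } 4,\\ 3 & \text{if } n \text{ is even but not divisible by } 4,\\ \infty & \text{otherwise.}\end{cases}$$
   Context: An exact $(k,d)$-coloring of a graph $G=(V,E)$ is a map $c: V\to\{1,\dots,k\}$ such that every vertex has exactly $d$ neighbors of its own color; $\chi_d^=(G)$ is the least $k$ for which one exists, and $\chi_d^=(G)=\infty$ if none exists. -}

module Defs where

open import Data.Nat using (ℕ; zero; suc; _+_; _<_; _≤_; _%_)
open import Data.Fin using (Fin; toℕ)
open import Data.Fin.Properties using (_≟_)
open import Data.List using (List; length; filter)
open import Data.List.Base using (allFin)
open import Data.Product using (Σ; _×_; _,_)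
open import Data.Sum using (_⊎_)
open import Relation.Nullary using (¬_; Dec)
open import Relation.Nullary.Decidable using (_×-dec_; _⊎-dec_; ¬?)
open import Relation.Binary.PropositionalEquality using (_≡_; _≢_; cong; trans) renaming (sym to sym≡)
open import Data.Nat using (NonZero) renaming (_≟_ to _≟ℕ_)
open import Data.Nat.Properties using (m≤n⇒m<n∨m≡n; 1+n≢n; 0≢1+n)
open import Data.Nat.DivMod using (m<n⇒m%n≡m; n%n≡0)
open import Data.Fin.Properties using (toℕ<n)
open import Data.Sum using (inj₁; inj₂; [_,_]′; swap)

record Graph (n : ℕ) : Set₁ where
  field
    Adj      : Fin n → Fin n → Set
    adj?     : (u v : Fin n) → Dec (Adj u v)
    irrefl   : ∀ u → ¬ Adj u u
    sym      : ∀ u v → Adj u v → Adj v u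

open Graph public

sameColourNeighbours : ∀ {n k} (G : Graph n) (c : Fin n → Fin k) → Fin n → ℕ
sameColourNeighbours G c v =
  length (filter (λ u → adj? G v u ×-dec (c u ≟ c v)) (allFin _))

IsExactColouring : ∀ {n} (G : Graph n) (k d : ℕ) → (Fin n → Fin k) → Set
IsExactColouring G k d c = ∀ v → sameColourNeighbours G c v ≡ d

ExactColourable : ∀ {n} (G : Graph n) (k d : ℕ) → Set
ExactColourable G k d = Σ (Fin _ → Fin k) (IsExactColouring G k d)

data ℕ∞ : Set where
  fin : ℕ → ℕ∞
  ∞   : ℕ∞

ExactChromaticNumber : ∀ {n} (G : Graph n) (d : ℕ) → ℕ∞ → Set
ExactChromaticNumber G d (fin k) =
  ExactColourable G k d × (∀ j → j < k → ¬ ExactColourable G j d)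
ExactChromaticNumber G d ∞ = ∀ k → ¬ ExactColourable G k d

CycleAdj : ∀ n .{{_ : NonZero n}} → Fin n → Fin n → Set
CycleAdj n u v = (toℕ v ≡ suc (toℕ u) % n) ⊎ (toℕ u ≡ suc (toℕ v) % n)

private
  noLoop : ∀ n (u : Fin (suc (suc n))) → toℕ u ≢ suc (toℕ u) % suc (suc n)
  noLoop n u eq with toℕ<n u
  ... | lt with m≤n⇒m<n∨m≡n lt
  ... | inj₁ slt = 1+n≢n (sym≡ (trans eq (m<n⇒m%n≡m slt)))
  ... | inj₂ seq with trans eq (trans (cong (_% suc (suc n)) seq) (n%n≡0 (suc (suc n))))
  ...   | z rewrite z with seq
  ...     | ()

Cycle : ∀ m → Graph (3 + m)
Cycle m = record
  { Adj    = CycleAdj (3 + m)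
  ; adj?   = λ u v → (toℕ v ≟ℕ suc (toℕ u) % (3 + m)) ⊎-dec (toℕ u ≟ℕ suc (toℕ v) % (3 + m))
  ; irrefl = λ u → [ noLoop (suc m) u , noLoop (suc m) u ]′
  ; sym    = λ u v → swap
  }

-- At a vertex of C_n only its two incident edges matter, so a colouring is exact with d = 1
-- iff monochromatic and bichromatic edges alternate around the cycle. This forces n to be
-- even and rules out a single colour; with two colours the colours then repeat in the pattern
-- aabb, which closes up only when 4 ∣ n. Conversely, giving vertices 2r and 2r+1 the colour of
-- r in a proper colouring of C_{n/2} is exact, and C_{n/2} is properly 2-colourable when n/2
-- is even and properly 3-colourable in any case.

module Submission where

open import Defs hiding (sym)
open import Data.Bool using (Bool; true; false; not)
open import Data.Bool.Properties using (not-¬; not-involutive)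
open import Data.Empty using (⊥-elim)
open import Data.Fin using (Fin; zero; suc; toℕ; fromℕ; inject₁; opposite)
open import Data.Fin.Properties as Fin using (_≟_)
open import Data.List using ([]; _∷_; length; filter; allFin)
open import Data.List.Membership.Propositional using (_∈_)
open import Data.List.Membership.Propositional.Properties using (∈-allFin)
open import Data.List.Properties using (filter-≐; filter-none)
import Data.List.Relation.Unary.All as All
open import Data.List.Relation.Unary.Any using (here; there)
open import Data.List.Relation.Unary.AllPairs using (_∷_)
open import Data.List.Relation.Unary.Unique.Propositional using (Unique)
open import Data.List.Relation.Unary.Unique.Propositional.Properties using (allFin⁺)
open import Data.Nat as ℕ using (ℕ; zero; suc; _+_; _*_; _%_; _/_; _<_; _≤_; _<?_; z≤n; s≤s; s≤s⁻¹; NonZero)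
open import Data.Nat.DivMod
  using (_mod_; m%n<n; m<n⇒m%n≡m; n%n≡0; m%n%n≡m%n; [m+n]%n≡m%n; [m+kn]%n≡m%n; %-distribˡ-+; %-congʳ;
         m≡m%n+[m/n]*n; m/n≡1+[m∸n]/n; /-congˡ; m%[n*o]/o≡m/o%n)
open import Data.Nat.Divisibility using (_∣_; divides; m%n≡0⇒n∣m)
open import Data.Nat.Properties
  using (+-comm; +-identityʳ; +-suc; *-assoc; suc-injective; ≤-antisym; ≮⇒≥; <⇒≢; <⇒≱; m≤n⇒m<n∨m≡n; m*n≢0)
open import Data.Nat.Tactic.RingSolver using (solve-∀)
open import Data.Product using (_×_; _,_; proj₁; proj₂; ∃-syntax)
open import Data.Sum as Sum using (_⊎_; inj₁; inj₂)
open import Function using (_∘_; mk⇔)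
open import Relation.Binary.Definitions using (DecidableEquality)
open import Relation.Binary.PropositionalEquality
open import Relation.Nullary using (Dec; yes; no; does; ¬_; contradiction)
open import Relation.Nullary.Decidable using (_×-dec_; _⊎-dec_; dec-true; dec-false; does-⇔)
open import Relation.Unary using (Pred; Decidable; _≐_)

indicator : Bool → ℕ
indicator true  = 1
indicator false = 0

indicator-+≡1 : ∀ x y → indicator x + indicator y ≡ 1 → y ≡ not x
indicator-+≡1 true  false _ = refl
indicator-+≡1 false true  _ = refl

module _ {a p q} {A : Set a} {P : Pred A p} {Q : Pred A q}
         (P? : Decidable P) (Q? : Decidable Q) where

  length-filter-⊎ : (∀ {x} → P x → ¬ Q x) → ∀ xs →
    length (filter (λ x → P? x ⊎-dec Q? x) xs) ≡ length (filter P? xs) + length (filter Q? xs)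
  length-filter-⊎ P∩Q=∅ [] = refl
  length-filter-⊎ P∩Q=∅ (x ∷ xs) with P? x | Q? x
  ... | yes px | yes qx = contradiction qx (P∩Q=∅ px)
  ... | yes _  | no _   = cong suc (length-filter-⊎ P∩Q=∅ xs)
  ... | no _   | yes _  = trans (cong suc (length-filter-⊎ P∩Q=∅ xs)) (sym (+-suc _ _))
  ... | no _   | no _   = length-filter-⊎ P∩Q=∅ xs

module _ {a} {A : Set a} (_≟ᴬ_ : DecidableEquality A) where

  length-filter-≟-unique : ∀ {x xs} → Unique xs → x ∈ xs → length (filter (_≟ᴬ x) xs) ≡ 1
  length-filter-≟-unique {x} {y ∷ ys} (y∉ys ∷ _) x∈y∷ys with y ≟ᴬ x
  length-filter-≟-unique (y∉ys ∷ _) x∈y∷ys | yes refl =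
    cong (suc ∘ length) (filter-none (_≟ᴬ _) (All.map (λ y≢z z≡y → y≢z (sym z≡y)) y∉ys))
  length-filter-≟-unique (y∉ys ∷ _) (here refl)  | no y≢x = contradiction refl y≢x
  length-filter-≟-unique (y∉ys ∷ u) (there x∈ys) | no y≢x = length-filter-≟-unique u x∈ys

  length-filter-≟-× : ∀ {b} {B : Set b} (B? : Dec B) {x xs} → Unique xs → x ∈ xs →
    length (filter (λ y → (y ≟ᴬ x) ×-dec B?) xs) ≡ indicator (does B?)
  length-filter-≟-× (yes b) {xs = xs} u x∈xs =
    trans (cong length (filter-≐ _ _ (proj₁ , (_, b)) xs)) (length-filter-≟-unique u x∈xs)
  length-filter-≟-× (no ¬b) {xs = xs} _ _ =
    cong length (filter-none _ (All.universal (λ _ → ¬b ∘ proj₂) xs))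

sameColourNeighbours-two : ∀ {n k} (G : Graph n) (c : Fin n → Fin k) {v p q : Fin n} → p ≢ q →
  Adj G v ≐ (λ u → u ≡ p ⊎ u ≡ q) →
  sameColourNeighbours G c v ≡ indicator (does (c p ≟ c v)) + indicator (does (c q ≟ c v))
sameColourNeighbours-two {n} G c {v} {p} {q} p≢q (nbr⊆ , nbr⊇) = begin
  length (filter (λ u → adj? G v u ×-dec (c u ≟ c v)) (allFin n))
    ≡⟨ cong length (filter-≐ _ _ (split , merge) (allFin n)) ⟩
  length (filter (λ u → ((u ≟ p) ×-dec (c p ≟ c v)) ⊎-dec ((u ≟ q) ×-dec (c q ≟ c v))) (allFin n))
    ≡⟨ length-filter-⊎ _ _ (λ (u≡p , _) (u≡q , _) → p≢q (trans (sym u≡p) u≡q)) (allFin n) ⟩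
  length (filter (λ u → (u ≟ p) ×-dec (c p ≟ c v)) (allFin n)) +
  length (filter (λ u → (u ≟ q) ×-dec (c q ≟ c v)) (allFin n))
    ≡⟨ cong₂ _+_ (length-filter-≟-× _≟_ (c p ≟ c v) (allFin⁺ n) (∈-allFin p))
                 (length-filter-≟-× _≟_ (c q ≟ c v) (allFin⁺ n) (∈-allFin q)) ⟩
  indicator (does (c p ≟ c v)) + indicator (does (c q ≟ c v)) ∎
  where
  open ≡-Reasoning
  split : ∀ {u} → Adj G v u × c u ≡ c v → (u ≡ p × c p ≡ c v) ⊎ (u ≡ q × c q ≡ c v)
  split (vu , cu≡cv) with nbr⊆ vu
  ... | inj₁ refl = inj₁ (refl , cu≡cv)
  ... | inj₂ refl = inj₂ (refl , cu≡cv)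
  merge : ∀ {u} → (u ≡ p × c p ≡ c v) ⊎ (u ≡ q × c q ≡ c v) → Adj G v u × c u ≡ c v
  merge (inj₁ (refl , cp≡cv)) = nbr⊇ (inj₁ refl) , cp≡cv
  merge (inj₂ (refl , cq≡cv)) = nbr⊇ (inj₂ refl) , cq≡cv

%-cong-+ˡ : ∀ {a b} c n .{{_ : NonZero n}} → a % n ≡ b % n → (c + a) % n ≡ (c + b) % n
%-cong-+ˡ {a} {b} c n a≡b = begin
  (c + a) % n           ≡⟨ %-distribˡ-+ c a n ⟩
  (c % n + a % n) % n   ≡⟨ cong (λ x → (c % n + x) % n) a≡b ⟩
  (c % n + b % n) % n   ≡⟨ %-distribˡ-+ c b n ⟨
  (c + b) % n           ∎
  where open ≡-Reasoning

suc-%-cong : ∀ a n .{{_ : NonZero n}} → suc (a % n) % n ≡ suc a % n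
suc-%-cong a n = %-cong-+ˡ 1 n (m%n%n≡m%n a n)

%-cancel-+ˡ : ∀ {a b} c n .{{_ : NonZero n}} → (c + a) % n ≡ (c + b) % n → a % n ≡ b % n
%-cancel-+ˡ {a} {b} c (suc n-1) c+a≡c+b = begin
  a % suc n-1                   ≡⟨ unshift a ⟩
  (c * n-1 + (c + a)) % suc n-1 ≡⟨ %-cong-+ˡ (c * n-1) (suc n-1) c+a≡c+b ⟩
  (c * n-1 + (c + b)) % suc n-1 ≡⟨ unshift b ⟨
  b % suc n-1                   ∎
  where
  open ≡-Reasoning
  rearrange : ∀ x c k → x + c * suc k ≡ c * k + (c + x)
  rearrange = solve-∀
  unshift : ∀ x → x % suc n-1 ≡ (c * n-1 + (c + x)) % suc n-1
  unshift x = begin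
    x % suc n-1                   ≡⟨ [m+kn]%n≡m%n x c (suc n-1) ⟨
    (x + c * suc n-1) % suc n-1   ≡⟨ cong (_% suc n-1) (rearrange x c n-1) ⟩
    (c * n-1 + (c + x)) % suc n-1 ∎

module _ (m : ℕ) where

  vertex : ℕ → Fin (3 + m)
  vertex i = i mod (3 + m)

  toℕ-vertex : ∀ i → toℕ (vertex i) ≡ i % (3 + m)
  toℕ-vertex i = Fin.toℕ-fromℕ< (m%n<n i (3 + m))

  vertex-toℕ : ∀ v → vertex (toℕ v) ≡ v
  vertex-toℕ v = Fin.toℕ-injective (trans (toℕ-vertex (toℕ v)) (m<n⇒m%n≡m (Fin.toℕ<n v)))

  vertex-+n : ∀ i → vertex (i + (3 + m)) ≡ vertex i
  vertex-+n i = Fin.toℕ-injective (begin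
    toℕ (vertex (i + (3 + m))) ≡⟨ toℕ-vertex (i + (3 + m)) ⟩
    (i + (3 + m)) % (3 + m)    ≡⟨ [m+n]%n≡m%n i (3 + m) ⟩
    i % (3 + m)                ≡⟨ toℕ-vertex i ⟨
    toℕ (vertex i)             ∎)
    where open ≡-Reasoning

  toℕ-vertex-suc : ∀ i → suc (toℕ (vertex i)) % (3 + m) ≡ toℕ (vertex (suc i))
  toℕ-vertex-suc i = begin
    suc (toℕ (vertex i)) % (3 + m) ≡⟨ cong (λ x → suc x % (3 + m)) (toℕ-vertex i) ⟩
    suc (i % (3 + m)) % (3 + m)    ≡⟨ suc-%-cong i (3 + m) ⟩
    suc i % (3 + m)                ≡⟨ toℕ-vertex (suc i) ⟨
    toℕ (vertex (suc i))           ∎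
    where open ≡-Reasoning

  -- This is where n ≥ 3 enters: the residues 0 and 2 below are distinct.
  vertex≢vertex-2+ : ∀ i → vertex i ≢ vertex (2 + i)
  vertex≢vertex-2+ i eq with %-cancel-+ˡ {0} {2} i (3 + m) (begin
      (i + 0) % (3 + m)    ≡⟨ cong (_% (3 + m)) (+-identityʳ i) ⟩
      i % (3 + m)          ≡⟨ toℕ-vertex i ⟨
      toℕ (vertex i)       ≡⟨ cong toℕ eq ⟩
      toℕ (vertex (2 + i)) ≡⟨ toℕ-vertex (2 + i) ⟩
      (2 + i) % (3 + m)    ≡⟨ cong (_% (3 + m)) (+-comm 2 i) ⟩
      (i + 2) % (3 + m)    ∎)
    where open ≡-Reasoning
  ... | ()

  cycle-neighbours : ∀ i → Adj (Cycle m) (vertex (suc i)) ≐ (λ u → u ≡ vertex i ⊎ u ≡ vertex (2 + i))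
  cycle-neighbours i = into , from
    where
    into : ∀ {u} → Adj (Cycle m) (vertex (suc i)) u → u ≡ vertex i ⊎ u ≡ vertex (2 + i)
    into (inj₁ u≡next) = inj₂ (Fin.toℕ-injective (trans u≡next (toℕ-vertex-suc (suc i))))
    into {u} (inj₂ prev≡u) = inj₁ (Fin.toℕ-injective (begin
      toℕ u            ≡⟨ m<n⇒m%n≡m (Fin.toℕ<n u) ⟨
      toℕ u % (3 + m)  ≡⟨ %-cancel-+ˡ {toℕ u} {i} 1 (3 + m) (trans (sym prev≡u) (toℕ-vertex (suc i))) ⟩
      i % (3 + m)      ≡⟨ toℕ-vertex i ⟨
      toℕ (vertex i)   ∎))
      where open ≡-Reasoning
    from : ∀ {u} → u ≡ vertex i ⊎ u ≡ vertex (2 + i) → Adj (Cycle m) (vertex (suc i)) u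
    from (inj₁ refl) = inj₂ (sym (toℕ-vertex-suc i))
    from (inj₂ refl) = inj₁ (sym (toℕ-vertex-suc (suc i)))

  vertex-suc-surjective : ∀ v → ∃[ i ] vertex (suc i) ≡ v
  vertex-suc-surjective v = toℕ v + (2 + m) , (begin
    vertex (suc (toℕ v + (2 + m))) ≡⟨ cong vertex (+-suc (toℕ v) (2 + m)) ⟨
    vertex (toℕ v + (3 + m))       ≡⟨ vertex-+n (toℕ v) ⟩
    vertex (toℕ v)                 ≡⟨ vertex-toℕ v ⟩
    v                              ∎)
    where open ≡-Reasoning

  sameColourNeighbours-cycle : ∀ {k} (c : Fin (3 + m) → Fin k) i →
    sameColourNeighbours (Cycle m) c (vertex (suc i)) ≡
    indicator (does (c (vertex i) ≟ c (vertex (suc i)))) +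
    indicator (does (c (vertex (2 + i)) ≟ c (vertex (suc i))))
  sameColourNeighbours-cycle c i =
    sameColourNeighbours-two (Cycle m) c (vertex≢vertex-2+ i) (cycle-neighbours i)

colourAt : ∀ {m k} → (Fin (3 + m) → Fin k) → ℕ → Fin k
colourAt {m} c i = c (vertex m i)

monochromatic : ∀ {m k} → (Fin (3 + m) → Fin k) → ℕ → Bool
monochromatic c i = does (colourAt c i ≟ colourAt c (suc i))

module _ {m k} {c : Fin (3 + m) → Fin k} (exact : IsExactColouring (Cycle m) k 1 c) where

  monochromatic-alternates : ∀ i → monochromatic c (suc i) ≡ not (monochromatic c i)
  monochromatic-alternates i = indicator-+≡1 _ _ (begin
    indicator (monochromatic c i) + indicator (monochromatic c (suc i))
      ≡⟨ cong (λ b → indicator (monochromatic c i) + indicator b)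
              (does-⇔ (mk⇔ sym sym) (colourAt c (2 + i) ≟ colourAt c (suc i))
                                      (colourAt c (suc i) ≟ colourAt c (2 + i))) ⟨
    indicator (monochromatic c i) + indicator (does (colourAt c (2 + i) ≟ colourAt c (suc i)))
      ≡⟨ sameColourNeighbours-cycle m c i ⟨
    sameColourNeighbours (Cycle m) c (vertex m (suc i))
      ≡⟨ exact (vertex m (suc i)) ⟩
    1 ∎)
    where open ≡-Reasoning

  monochromatic-*2 : ∀ t → monochromatic c (t * 2) ≡ monochromatic c 0
  monochromatic-*2 zero    = refl
  monochromatic-*2 (suc t) = begin
    monochromatic c (2 + t * 2)         ≡⟨ monochromatic-alternates (suc (t * 2)) ⟩
    not (monochromatic c (suc (t * 2))) ≡⟨ cong not (monochromatic-alternates (t * 2)) ⟩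
    not (not (monochromatic c (t * 2))) ≡⟨ not-involutive _ ⟩
    monochromatic c (t * 2)             ≡⟨ monochromatic-*2 t ⟩
    monochromatic c 0                   ∎
    where open ≡-Reasoning

  monochromatic-periodic : ∀ i → monochromatic c (i + (3 + m)) ≡ monochromatic c i
  monochromatic-periodic i =
    cong₂ (λ u v → does (c u ≟ c v)) (vertex-+n m i) (vertex-+n m (suc i))

¬exactColourable-odd : ∀ m {k} t → 3 + m ≡ suc (t * 2) → ¬ ExactColourable (Cycle m) k 1
¬exactColourable-odd m t n≡1+2t (c , exact) = not-¬ refl (begin
  monochromatic c 0                   ≡⟨ monochromatic-periodic exact 0 ⟨
  monochromatic c (3 + m)             ≡⟨ cong (monochromatic c) n≡1+2t ⟩
  monochromatic c (suc (t * 2))       ≡⟨ monochromatic-alternates exact (t * 2) ⟩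
  not (monochromatic c (t * 2))       ≡⟨ cong not (monochromatic-*2 exact t) ⟩
  not (monochromatic c 0)             ∎)
  where open ≡-Reasoning

exactColourable⇒2≤k : ∀ m {k} → ExactColourable (Cycle m) k 1 → 2 ≤ k
exactColourable⇒2≤k m {0}           (c , _)     = ⊥-elim (Fin.¬Fin0 (c zero))
exactColourable⇒2≤k m {1}           (c , exact) =
  contradiction (trans (sym (always 1)) (trans (monochromatic-alternates exact 0) (cong not (always 0)))) λ ()
  where
  always : ∀ i → monochromatic c i ≡ true
  always i with colourAt c i | colourAt c (suc i)
  ... | zero | zero = refl
exactColourable⇒2≤k m {suc (suc _)} _           = s≤s (s≤s z≤n)

opposite-≢ : (x : Fin 2) → opposite x ≢ x
opposite-≢ zero       ()
opposite-≢ (suc zero) ()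

≢⇒≡opposite : {x y : Fin 2} → x ≢ y → y ≡ opposite x
≢⇒≡opposite {zero}     {zero}     x≢y = contradiction refl x≢y
≢⇒≡opposite {zero}     {suc zero} _   = refl
≢⇒≡opposite {suc zero} {zero}     _   = refl
≢⇒≡opposite {suc zero} {suc zero} x≢y = contradiction refl x≢y

module _ {m} {c : Fin (3 + m) → Fin 2} (exact : IsExactColouring (Cycle m) 2 1 c) where

  -- The two omitted cases contradict the alternation of monochromatic edges.
  colourAt-2+ : ∀ i → colourAt c (2 + i) ≡ opposite (colourAt c i)
  colourAt-2+ i with colourAt c i ≟ colourAt c (suc i) | colourAt c (suc i) ≟ colourAt c (2 + i)
                   | monochromatic-alternates exact i
  ... | yes same   | no differ | _ = trans (≢⇒≡opposite differ) (cong opposite (sym same))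
  ... | no differ  | yes same  | _ = trans (sym same) (≢⇒≡opposite differ)

  colourAt-*4 : ∀ s → colourAt c (s * 4) ≡ colourAt c 0
  colourAt-*4 zero    = refl
  colourAt-*4 (suc s) = begin
    colourAt c (2 + (2 + s * 4))             ≡⟨ colourAt-2+ (2 + s * 4) ⟩
    opposite (colourAt c (2 + s * 4))        ≡⟨ cong opposite (colourAt-2+ (s * 4)) ⟩
    opposite (opposite (colourAt c (s * 4))) ≡⟨ Fin.opposite-involutive _ ⟩
    colourAt c (s * 4)                       ≡⟨ colourAt-*4 s ⟩
    colourAt c 0                             ∎
    where open ≡-Reasoning

¬exactColourable-2-colours : ∀ m s → 3 + m ≡ 2 + s * 4 → ¬ ExactColourable (Cycle m) 2 1
¬exactColourable-2-colours m s n≡2+4s (c , exact) = opposite-≢ (colourAt c 0) (begin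
  opposite (colourAt c 0)        ≡⟨ cong opposite (colourAt-*4 exact s) ⟨
  opposite (colourAt c (s * 4))  ≡⟨ colourAt-2+ exact (s * 4) ⟨
  colourAt c (2 + s * 4)         ≡⟨ cong (colourAt c) n≡2+4s ⟨
  colourAt c (3 + m)             ≡⟨ cong c (vertex-+n m 0) ⟩
  colourAt c 0                   ∎)
  where open ≡-Reasoning

-- The values of G on 0, …, h − 1 properly colour C_h; later values are irrelevant.
record IsProperCycleColouring {k} (h : ℕ) (G : ℕ → Fin k) : Set where
  field
    along : ∀ r → suc r < h → G r ≢ G (suc r)
    wraps : ∀ r → suc r ≡ h → G r ≢ G 0

isProperCycleColouring⇒≢-% : ∀ {k h} .{{_ : NonZero h}} {G : ℕ → Fin k} →
  IsProperCycleColouring h G → ∀ q → G (q % h) ≢ G (suc q % h)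
isProperCycleColouring⇒≢-% {h = h} {G} proper q with suc (q % h) <? h
... | yes 1+r<h = λ eq → along (q % h) 1+r<h (trans eq (cong G (begin
  suc q % h           ≡⟨ suc-%-cong q h ⟨
  suc (q % h) % h     ≡⟨ m<n⇒m%n≡m 1+r<h ⟩
  suc (q % h)         ∎)))
  where open ≡-Reasoning; open IsProperCycleColouring proper
... | no 1+r≮h = λ eq → wraps (q % h) 1+r≡h (trans eq (cong G (begin
  suc q % h           ≡⟨ suc-%-cong q h ⟨
  suc (q % h) % h     ≡⟨ cong (_% h) 1+r≡h ⟩
  h % h               ≡⟨ n%n≡0 h ⟩
  0                   ∎)))
  where
  open ≡-Reasoning; open IsProperCycleColouring proper
  1+r≡h : suc (q % h) ≡ h
  1+r≡h = ≤-antisym (m%n<n q h) (≮⇒≥ 1+r≮h)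

suc[suc[i]]/2≡suc[i/2] : ∀ i → suc (suc i) / 2 ≡ suc (i / 2)
suc[suc[i]]/2≡suc[i/2] i = m/n≡1+[m∸n]/n {suc (suc i)} (s≤s (s≤s z≤n))

suc[i]/2≡i/2⊎suc[i/2] : ∀ i → suc i / 2 ≡ i / 2 ⊎ suc i / 2 ≡ suc (i / 2)
suc[i]/2≡i/2⊎suc[i/2] 0 = inj₁ refl
suc[i]/2≡i/2⊎suc[i/2] 1 = inj₂ refl
suc[i]/2≡i/2⊎suc[i/2] (suc (suc i))
  rewrite suc[suc[i]]/2≡suc[i/2] (suc i) | suc[suc[i]]/2≡suc[i/2] i
  = Sum.map (cong suc) (cong suc) (suc[i]/2≡i/2⊎suc[i/2] i)

exactly-one-agrees : ∀ {k} {x y z : Fin k} → x ≢ z → y ≡ x ⊎ y ≡ z →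
  indicator (does (x ≟ y)) + indicator (does (z ≟ y)) ≡ 1
exactly-one-agrees {x = x} {z = z} x≢z (inj₁ refl) =
  cong₂ _+_ (cong indicator (dec-true (x ≟ x) refl)) (cong indicator (dec-false (z ≟ x) (x≢z ∘ sym)))
exactly-one-agrees {x = x} {z = z} x≢z (inj₂ refl) =
  cong₂ _+_ (cong indicator (dec-false (x ≟ z) x≢z)) (cong indicator (dec-true (z ≟ z) refl))

exactColourable-from-proper : ∀ m {k} h .{{_ : NonZero h}} → 3 + m ≡ h * 2 →
  (G : ℕ → Fin k) → IsProperCycleColouring h G → ExactColourable (Cycle m) k 1
exactColourable-from-proper m {k} h n≡2h G proper = c , exact
  where
  open ≡-Reasoning
  instance
    nonZero-2h : NonZero (h * 2)
    nonZero-2h = m*n≢0 h 2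
  H : ℕ → Fin k
  H q = G (q % h)
  c : Fin (3 + m) → Fin k
  c u = G (toℕ u / 2)
  colour-vertex : ∀ j → c (vertex m j) ≡ H (j / 2)
  colour-vertex j = cong G (begin
    toℕ (vertex m j) / 2   ≡⟨ /-congˡ (toℕ-vertex m j) ⟩
    j % (3 + m) / 2        ≡⟨ /-congˡ (%-congʳ n≡2h) ⟩
    j % (h * 2) / 2        ≡⟨ m%[n*o]/o≡m/o%n j h 2 ⟩
    j / 2 % h              ∎)
  agree : Fin k → Fin k → ℕ
  agree x y = indicator (does (x ≟ y))
  exact-at-suc : ∀ i → sameColourNeighbours (Cycle m) c (vertex m (suc i)) ≡ 1
  exact-at-suc i = begin
    sameColourNeighbours (Cycle m) c (vertex m (suc i))
      ≡⟨ sameColourNeighbours-cycle m c i ⟩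
    agree (c (vertex m i)) (c (vertex m (suc i))) + agree (c (vertex m (2 + i))) (c (vertex m (suc i)))
      ≡⟨ cong₂ _+_ (cong₂ agree (colour-vertex i) (colour-vertex (suc i)))
                   (cong₂ agree (trans (colour-vertex (2 + i)) (cong H (suc[suc[i]]/2≡suc[i/2] i)))
                                (colour-vertex (suc i))) ⟩
    agree (H (i / 2)) (H (suc i / 2)) + agree (H (suc (i / 2))) (H (suc i / 2))
      ≡⟨ exactly-one-agrees (isProperCycleColouring⇒≢-% proper (i / 2))
                            (Sum.map (cong H) (cong H) (suc[i]/2≡i/2⊎suc[i/2] i)) ⟩
    1 ∎
  exact : IsExactColouring (Cycle m) k 1 c
  exact v with vertex-suc-surjective m v
  ... | i , refl = exact-at-suc i

alternating : ℕ → Fin 2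
alternating zero          = zero
alternating (suc zero)    = suc zero
alternating (suc (suc i)) = alternating i

alternating-≢-suc : ∀ i → alternating i ≢ alternating (suc i)
alternating-≢-suc zero          ()
alternating-≢-suc (suc zero)    ()
alternating-≢-suc (suc (suc i)) = alternating-≢-suc i

alternating-odd : ∀ t → alternating (suc (t * 2)) ≡ suc zero
alternating-odd zero    = refl
alternating-odd (suc t) = alternating-odd t

alternating-proper : ∀ t → IsProperCycleColouring (suc t * 2) alternating
alternating-proper t = record { along = λ r _ → alternating-≢-suc r ; wraps = wraps }
  where
  wraps : ∀ r → suc r ≡ suc t * 2 → alternating r ≢ alternating 0
  wraps r 1+r≡h rewrite suc-injective 1+r≡h | alternating-odd t = λ ()

alternatingWithLast : ℕ → ℕ → Fin 3
alternatingWithLast last x with x ℕ.≟ last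
... | yes _ = fromℕ 2
... | no _  = inject₁ (alternating x)

alternatingWithLast-proper : ∀ last → 0 < last → IsProperCycleColouring (suc last) (alternatingWithLast last)
alternatingWithLast-proper last 0<last = record { along = along ; wraps = wraps }
  where
  along : ∀ r → suc r < suc last → alternatingWithLast last r ≢ alternatingWithLast last (suc r)
  along r 1+r<h with r ℕ.≟ last | suc r ℕ.≟ last
  ... | yes r≡last | _     = contradiction r≡last (<⇒≢ (s≤s⁻¹ 1+r<h))
  ... | no _       | yes _ = Fin.fromℕ≢inject₁ ∘ sym
  ... | no _       | no _  = alternating-≢-suc r ∘ Fin.inject₁-injective
  wraps : ∀ r → suc r ≡ suc last → alternatingWithLast last r ≢ alternatingWithLast last 0
  wraps r 1+r≡h with r ℕ.≟ last | 0 ℕ.≟ last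
  ... | no r≢last | _          = contradiction (suc-injective 1+r≡h) r≢last
  ... | yes _     | yes 0≡last = contradiction 0≡last (<⇒≢ 0<last)
  ... | yes _     | no _       = Fin.fromℕ≢inject₁

¬2∣n⇒n≡1+t*2 : ∀ n → ¬ 2 ∣ n → ∃[ t ] n ≡ suc (t * 2)
¬2∣n⇒n≡1+t*2 n 2∤n with n % 2 | m%n<n n 2 | m≡m%n+[m/n]*n n 2 | m%n≡0⇒n∣m n 2
... | 0           | _            | _   | 2∣n = contradiction (2∣n refl) 2∤n
... | 1           | _            | n≡  | _   = n / 2 , n≡
... | suc (suc _) | s≤s (s≤s ()) | _   | _

2∣n∧¬4∣n⇒n≡2+s*4 : ∀ {n} → 2 ∣ n → ¬ 4 ∣ n → ∃[ s ] n ≡ 2 + s * 4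
2∣n∧¬4∣n⇒n≡2+s*4 (divides q refl) 4∤n
  with ¬2∣n⇒n≡1+t*2 q (λ { (divides t refl) → 4∤n (divides t (*-assoc t 2 2)) })
... | s , refl = s , cong (2 +_) (*-assoc s 2 2)

exactChromaticNumber-4∣n : ∀ m → 4 ∣ 3 + m → ExactChromaticNumber (Cycle m) 1 (fin 2)
exactChromaticNumber-4∣n m (divides (suc t) n≡4q) =
  exactColourable-from-proper m (suc t * 2) (trans n≡4q (sym (*-assoc (suc t) 2 2)))
                              alternating (alternating-proper t) ,
  λ j j<2 → <⇒≱ j<2 ∘ exactColourable⇒2≤k m

exactChromaticNumber-2∣n∧¬4∣n : ∀ m → 2 ∣ 3 + m → ¬ 4 ∣ 3 + m → ExactChromaticNumber (Cycle m) 1 (fin 3)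
exactChromaticNumber-2∣n∧¬4∣n m 2∣n 4∤n with 2∣n∧¬4∣n⇒n≡2+s*4 2∣n 4∤n
... | suc s , n≡2+4s =
  exactColourable-from-proper m (suc (suc s * 2)) (trans n≡2+4s (cong (2 +_) (sym (*-assoc (suc s) 2 2))))
                              (alternatingWithLast (suc s * 2)) (alternatingWithLast-proper (suc s * 2) (s≤s z≤n)) ,
  fewer
  where
  fewer : ∀ j → j < 3 → ¬ ExactColourable (Cycle m) j 1
  fewer j j<3 with m≤n⇒m<n∨m≡n (s≤s⁻¹ j<3)
  ... | inj₁ j<2  = <⇒≱ j<2 ∘ exactColourable⇒2≤k m
  ... | inj₂ refl = ¬exactColourable-2-colours m (suc s) n≡2+4s

exactChromaticNumber-odd : ∀ m → ¬ 2 ∣ 3 + m → ExactChromaticNumber (Cycle m) 1 ∞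
exactChromaticNumber-odd m 2∤n k with ¬2∣n⇒n≡1+t*2 (3 + m) 2∤n
... | t , n≡1+2t = ¬exactColourable-odd m t n≡1+2t

mainTheorem7 : (m : ℕ) →
    (4 ∣ (3 + m) → ExactChromaticNumber (Cycle m) 1 (fin 2)) ×
    (2 ∣ (3 + m) → ¬ (4 ∣ (3 + m)) → ExactChromaticNumber (Cycle m) 1 (fin 3)) ×
    (¬ (2 ∣ (3 + m)) → ExactChromaticNumber (Cycle m) 1 ∞)
mainTheorem7 m = exactChromaticNumber-4∣n m , exactChromaticNumber-2∣n∧¬4∣n m , exactChromaticNumber-odd m
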